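{- Let $q=q_1q_2\cdots q_k$ be an involution of length $k>2$ such that if $q_i=k$ then $i\leq k-2$. Let $C_n(q)$ be the number of cyclic permutations of length $n$ that avoid $q$. Then for all $n\geq 2$, $2C_n(q)\leq C_{n+1}(q)$.
   Context: A permutation of length $n$ is a linear order $p=p_1p_2\cdots p_n$ of $[n]=\{1,\dots,n\}$, also viewed as the bijection $i\mapsto p_i$. It is cyclic if, as a bijection of $[n]$, it consists of a single cycle of length $n$; it is an involution if its square is the identity. A permutation $p$ contains a pattern $q=q_1\cdots q_k$ if there are indices $i_1<\cdots<i_k$ such that for all $j,r$, $q_j<q_r$ iff $p_{i_j}<p_{i_r}$; otherwise $p$ avoids $q$. -}

module Defs where

open import Data.Nat using (ℕ; zero; suc)
open import Data.Fin using (Fin; _<_)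
open import Data.Vec using (Vec; lookup)
open import Data.Product using (Σ; ∃; _×_)
open import Data.Irrelevant using (Irrelevant)
open import Function using (_∘_; _⇔_)
open import Function.Definitions using (Bijective)
open import Relation.Binary.PropositionalEquality using (_≡_)

-- A word of length n over [n] (0-indexed: values in Fin n), p = p₁⋯pₙ,
-- viewed as the map i ↦ pᵢ.
Word : ℕ → Set
Word n = Vec (Fin n) n

IsPerm : ∀ {n} → Word n → Set
IsPerm p = Bijective _≡_ _≡_ (lookup p)

iter : ∀ {A : Set} → (A → A) → ℕ → A → A
iter f zero    x = x
iter f (suc m) x = f (iter f m x)

IsCyclic : ∀ {n} → Word n → Set
IsCyclic {n} p = IsPerm p × (∀ (i j : Fin n) → ∃ λ m → iter (lookup p) m i ≡ j)

IsInvolution : ∀ {k} → Word k → Set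
IsInvolution {k} q = IsPerm q × (∀ (i : Fin k) → lookup q (lookup q i) ≡ i)

Contains : ∀ {n k} → Word n → Word k → Set
Contains {n} {k} p q =
  Σ (Fin k → Fin n) λ e →
    (∀ (j r : Fin k) → j < r → e j < e r) ×
    (∀ (j r : Fin k) → (lookup q j < lookup q r) ⇔ (lookup p (e j) < lookup p (e r)))

Avoids : ∀ {n k} → Word n → Word k → Set
Avoids p q = Contains p q → Data.Empty.⊥
  where import Data.Empty

-- The proof component
-- is irrelevant, so elements are determined by the underlying word and the
-- cardinality of this type is the number C_n(q).
CycAv : ∀ {k} → Word k → ℕ → Set
CycAv q n = Σ (Word n) λ p → Irrelevant (IsCyclic p × Avoids p q)

module Submission where

-- 2 C_n(q) ≤ C_{n+1}(q) for an involution q of length k > 2 whose entry k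
-- sits at a position i₀ ≤ k - 2.  A cyclic permutation p of length n ≥ 2
-- yields two of length n + 1 by splicing the new point n + 1 into its cycle
--   (1) right after n:  p₁ ⋯ p_{n-1} (n+1) pₙ, or
--   (2) right after p⁻¹(n):  p with n raised to n + 1, followed by n.
-- Splicing keeps a single cycle, and it determines both the anchor and p; the
-- anchors n and p⁻¹(n) differ since p has no fixed point.  Both extensions
-- keep q-avoidance: an occurrence of q avoiding the entry n + 1 in (1) (resp.
-- the last entry in (2)) restricts to an occurrence in p, while using it
-- contradicts the position of k in q (resp. q_{k-1} = i₀ < k - 2).

open import Defs
open import Data.Nat using (ℕ; zero; suc; _+_; _*_; _≤_; _<_; s≤s)
import Data.Nat.Properties as ℕ
open import Data.Fin using (Fin; toℕ; zero; fromℕ; fromℕ<; inject₁) renaming (_<_ to _<ᶠ_)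
open import Data.Fin.Properties
  using (_≟_; any?; toℕ-injective; toℕ<n; toℕ-fromℕ; toℕ-fromℕ<; toℕ-inject₁;
         inject₁-injective; fromℕ≢inject₁; ≤fromℕ; +↔⊎; injective⇒≤)
open import Data.Fin.Relation.Unary.Top using (view; ‵fromℕ; ‵inject₁; view-fromℕ; view-inject₁)
open import Data.Vec using (lookup; tabulate)
open import Data.Vec.Properties using (lookup∘tabulate; tabulate∘lookup; tabulate-cong)
open import Data.Product using (Σ; ∃; _×_; _,_; proj₁; proj₂)
open import Data.Sum using (_⊎_; inj₁; inj₂)
open import Data.Sum.Function.Propositional using (_⊎-↔_)
open import Data.Empty using (⊥-elim; ⊥-elim-irr)
open import Data.Irrelevant using ([_])
open import Relation.Nullary using (¬_; yes; no; contradiction)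
open import Relation.Binary.Definitions using (tri<; tri≈; tri>)
open import Relation.Binary.PropositionalEquality
  using (_≡_; _≢_; _≗_; refl; sym; trans; cong; subst; subst₂; module ≡-Reasoning)
open import Function using (_∘_; _⇔_; mk⇔; _↔_; _↣_; mk↣; Injection; Equivalence)
open import Function.Definitions using (Injective; Surjective)
open import Function.Properties.Inverse using (↔-sym; ↔⇒↣)
open import Function.Construct.Composition using (_↣-∘_; _↔-∘_; _⇔-∘_)

private
  variable
    k n : ℕ

Reaches : {A : Set} → (A → A) → A → A → Set
Reaches f x y = ∃ λ t → iter f t x ≡ y

Cyclic : (Fin n → Fin n) → Set
Cyclic f = ∀ x y → Reaches f x y

iter-+ : {A : Set} (f : A → A) (s t : ℕ) (x : A) → iter f (s + t) x ≡ iter f s (iter f t x)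
iter-+ f zero    t x = refl
iter-+ f (suc s) t x = cong f (iter-+ f s t x)

iter-cong : {A : Set} {f g : A → A} → f ≗ g → ∀ t x → iter f t x ≡ iter g t x
iter-cong f≗g zero    x = refl
iter-cong {f = f} f≗g (suc t) x = trans (cong f (iter-cong f≗g t x)) (f≗g _)

reach-trans : {A : Set} {f : A → A} {x y z : A} → Reaches f x y → Reaches f y z → Reaches f x z
reach-trans {f = f} {x} (s , refl) (t , refl) = t + s , iter-+ f t s x

cyclic-cong : {f g : Fin n → Fin n} → f ≗ g → Cyclic f → Cyclic g
cyclic-cong f≗g cyc x y = let t , eq = cyc x y in t , trans (sym (iter-cong f≗g t x)) eq

-- A single orbit is hit by f everywhere: y is the image of its predecessor.
cyclic⇒surjective : {f : Fin n → Fin n} → Cyclic f → Surjective _≡_ _≡_ f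
cyclic⇒surjective {f = f} cyc y with cyc (f y) y
... | zero  , fy≡y = y , λ { refl → fy≡y }
... | suc t , eq   = iter f t (f y) , λ { refl → eq }

cyclic-fixed-point : {f : Fin n → Fin n} {x : Fin n} → Cyclic f → f x ≡ x → ∀ y → y ≡ x
cyclic-fixed-point {f = f} {x} cyc fx≡x y = let t , eq = cyc x y in trans (sym eq) (stays t)
  where
  stays : ∀ t → iter f t x ≡ x
  stays zero    = refl
  stays (suc t) = trans (cong f (stays t)) fx≡x

below-last : (x : Fin (suc n)) → x ≢ fromℕ n → x <ᶠ fromℕ n
below-last x x≢last = ℕ.≤∧≢⇒< (≤fromℕ x) (x≢last ∘ toℕ-injective)

not-above-last : (x : Fin (suc n)) → ¬ (fromℕ n <ᶠ x)
not-above-last x = ℕ.≤⇒≯ (≤fromℕ x)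

at-least-last : (x : Fin (suc n)) → n ≤ toℕ x → x ≡ fromℕ n
at-least-last {n} x n≤x =
  toℕ-injective (ℕ.≤-antisym (≤fromℕ x) (subst (_≤ toℕ x) (sym (toℕ-fromℕ n)) n≤x))

inject₁-order : (x y : Fin n) → (inject₁ x <ᶠ inject₁ y) ⇔ (x <ᶠ y)
inject₁-order x y rewrite toℕ-inject₁ x | toℕ-inject₁ y = mk⇔ (λ lt → lt) (λ lt → lt)

-- insertAfter a h adds the point fromℕ n to Fin n and splices it into the
-- cycle structure of h directly after a:  a ↦ new ↦ h a,  x ↦ h x otherwise.
insertAfter : Fin n → (Fin n → Fin n) → Fin (suc n) → Fin (suc n)
insertAfter {n} a h u with view u
... | ‵fromℕ     = inject₁ (h a)
... | ‵inject₁ x with x ≟ a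
...   | yes _ = fromℕ n
...   | no  _ = inject₁ (h x)

collapse : Fin n → Fin (suc n) → Fin n
collapse a u with view u
... | ‵fromℕ     = a
... | ‵inject₁ x = x

module Insertion {n : ℕ} (a : Fin n) (h : Fin n → Fin n) where

  g : Fin (suc n) → Fin (suc n)
  g = insertAfter a h

  g-new : g (fromℕ n) ≡ inject₁ (h a)
  g-new rewrite view-fromℕ n = refl

  g-anchor : g (inject₁ a) ≡ fromℕ n
  g-anchor rewrite view-inject₁ a with a ≟ a
  ... | yes _   = refl
  ... | no  a≢a = contradiction refl a≢a

  g-old : ∀ {x} → x ≢ a → g (inject₁ x) ≡ inject₁ (h x)
  g-old {x} x≢a rewrite view-inject₁ x with x ≟ a
  ... | yes x≡a = contradiction x≡a x≢a
  ... | no  _   = refl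

  g-off-anchor : ∀ {u} → u ≢ inject₁ a → g u ≡ inject₁ (h (collapse a u))
  g-off-anchor {u} u≢a with view u
  ... | ‵fromℕ     = refl
  ... | ‵inject₁ x with x ≟ a
  ...   | yes x≡a = contradiction (cong inject₁ x≡a) u≢a
  ...   | no  _   = refl

  g-new-preimage : ∀ {u} → g u ≡ fromℕ n → u ≡ inject₁ a
  g-new-preimage {u} gu≡new with u ≟ inject₁ a
  ... | yes u≡a = u≡a
  ... | no  u≢a = contradiction (trans (sym gu≡new) (g-off-anchor u≢a)) fromℕ≢inject₁

  collapse-injective : ∀ {u v} → u ≢ inject₁ a → v ≢ inject₁ a →
                       collapse a u ≡ collapse a v → u ≡ v
  collapse-injective {u} {v} u≢a v≢a eq with view u | view v
  ... | ‵fromℕ     | ‵fromℕ     = refl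
  ... | ‵fromℕ     | ‵inject₁ y = contradiction (cong inject₁ (sym eq)) v≢a
  ... | ‵inject₁ x | ‵fromℕ     = contradiction (cong inject₁ eq) u≢a
  ... | ‵inject₁ x | ‵inject₁ y = cong inject₁ eq

  g-injective : Injective _≡_ _≡_ h → Injective _≡_ _≡_ g
  g-injective h-inj {u} {v} gu≡gv with u ≟ inject₁ a | v ≟ inject₁ a
  ... | yes u≡a | yes v≡a = trans u≡a (sym v≡a)
  ... | yes u≡a | no  _   =
    sym (trans (g-new-preimage (trans (sym gu≡gv) (trans (cong g u≡a) g-anchor))) (sym u≡a))
  ... | no  _   | yes v≡a = trans (g-new-preimage (trans gu≡gv (trans (cong g v≡a) g-anchor))) (sym v≡a)
  ... | no  u≢a | no  v≢a = collapse-injective u≢a v≢a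
    (h-inj (inject₁-injective (trans (sym (g-off-anchor u≢a)) (trans gu≡gv (g-off-anchor v≢a)))))

  -- Each step of h is replayed by g, through the new point when leaving a.
  step-old : ∀ x → Reaches g (inject₁ x) (inject₁ (h x))
  step-old x with x ≟ a
  ... | yes refl = 2 , trans (cong g g-anchor) g-new
  ... | no  x≢a  = 1 , g-old x≢a

  reach-old : ∀ {x y} → Reaches h x y → Reaches g (inject₁ x) (inject₁ y)
  reach-old (zero  , refl) = 0 , refl
  reach-old (suc t , refl) = reach-trans (reach-old (t , refl)) (step-old _)

  -- Inserting a point into a single cycle leaves a single cycle: every point
  -- reaches the anchor, and the anchor reaches every point.
  g-cyclic : Cyclic h → Cyclic g
  g-cyclic cyc u v = reach-trans (to-anchor u) (from-anchor v)
    where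
    to-anchor : ∀ u → Reaches g u (inject₁ a)
    to-anchor u with view u
    ... | ‵fromℕ     = reach-trans (1 , g-new) (reach-old (cyc (h a) a))
    ... | ‵inject₁ x = reach-old (cyc x a)
    from-anchor : ∀ v → Reaches g (inject₁ a) v
    from-anchor v with view v
    ... | ‵fromℕ     = 1 , g-anchor
    ... | ‵inject₁ y = reach-old (cyc a y)

insertAfter-determines : {a a' : Fin n} {h h' : Fin n → Fin n} →
                         insertAfter a h ≗ insertAfter a' h' → a ≡ a' × h ≗ h'
insertAfter-determines {n} {a} {a'} {h} {h'} eq = a≡a' , h≗h'
  where
  open Insertion
  open ≡-Reasoning
  a≡a' : a ≡ a'
  a≡a' = inject₁-injective
    (g-new-preimage a' h' (trans (sym (eq (inject₁ a))) (g-anchor a h)))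
  h≗h' : h ≗ h'
  h≗h' x with x ≟ a
  ... | yes refl = inject₁-injective (begin
    inject₁ (h a)                ≡⟨ g-new a h ⟨
    insertAfter a h (fromℕ n)    ≡⟨ eq (fromℕ n) ⟩
    insertAfter a' h' (fromℕ n)  ≡⟨ g-new a' h' ⟩
    inject₁ (h' a')              ≡⟨ cong (inject₁ ∘ h') a≡a' ⟨
    inject₁ (h' a)               ∎)
  ... | no  x≢a  = inject₁-injective (begin
    inject₁ (h x)                ≡⟨ g-old a h x≢a ⟨
    insertAfter a h (inject₁ x)  ≡⟨ eq (inject₁ x) ⟩
    insertAfter a' h' (inject₁ x) ≡⟨ g-old a' h' (λ x≡a' → x≢a (trans x≡a' (sym a≡a'))) ⟩
    inject₁ (h' x)               ∎)

extend : Word n → Fin n → Word (suc n)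
extend p a = tabulate (insertAfter a (lookup p))

extend-injective : {p p' : Word n} {a a' : Fin n} → extend p a ≡ extend p' a' → a ≡ a' × p ≡ p'
extend-injective {p = p} {p'} {a} {a'} eq =
  a≡a' , trans (sym (tabulate∘lookup p)) (trans (tabulate-cong p≗p') (tabulate∘lookup p'))
  where
  pointwise : insertAfter a (lookup p) ≗ insertAfter a' (lookup p')
  pointwise u = trans (sym (lookup∘tabulate (insertAfter a (lookup p)) u))
    (trans (cong (λ w → lookup w u) eq) (lookup∘tabulate (insertAfter a' (lookup p')) u))
  a≡a' : a ≡ a'
  a≡a' = proj₁ (insertAfter-determines pointwise)
  p≗p' : lookup p ≗ lookup p'
  p≗p' = proj₂ (insertAfter-determines pointwise)

extend-cyclic : {p : Word n} (a : Fin n) → IsCyclic p → IsCyclic (extend p a)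
extend-cyclic {p = p} a ((p-inj , _) , p-cyc) = (w-inj , cyclic⇒surjective w-cyc) , w-cyc
  where
  open Insertion a (lookup p)
  w≗g : lookup (extend p a) ≗ g
  w≗g = lookup∘tabulate g
  w-inj : Injective _≡_ _≡_ (lookup (extend p a))
  w-inj {x} {y} eq = g-injective p-inj (trans (sym (w≗g x)) (trans eq (w≗g y)))
  w-cyc : Cyclic (lookup (extend p a))
  w-cyc = cyclic-cong (sym ∘ w≗g) (g-cyclic p-cyc)

Increasing : {N : ℕ} → (Fin k → Fin N) → Set
Increasing {k} e = ∀ (j r : Fin k) → j <ᶠ r → e j <ᶠ e r

Occurs : {N : ℕ} → (Fin N → Fin N) → Word k → Set
Occurs {k} {N} f q = Σ (Fin k → Fin N) λ e → Increasing e ×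
  (∀ (j r : Fin k) → (lookup q j <ᶠ lookup q r) ⇔ (f (e j) <ᶠ f (e r)))

occurs-cong : {N : ℕ} {f f' : Fin N → Fin N} {q : Word k} → f ≗ f' → Occurs f q → Occurs f' q
occurs-cong f≗f' (e , inc , iff) = e , inc , λ j r →
  subst₂ (λ s t → (_ ⇔ (s <ᶠ t))) (f≗f' (e j)) (f≗f' (e r)) (iff j r)

increasing-injective : {N : ℕ} {e : Fin k → Fin N} → Increasing e → ∀ {j r} → e j ≡ e r → j ≡ r
increasing-injective {e = e} inc {j} {r} ej≡er with ℕ.<-cmp (toℕ j) (toℕ r)
... | tri< j<r _ _ = contradiction (inc j r j<r) (ℕ.<-irrefl (cong toℕ ej≡er))
... | tri≈ _ j≡r _ = toℕ-injective j≡r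
... | tri> _ _ r<j = contradiction (inc r j r<j) (ℕ.<-irrefl (cong toℕ (sym ej≡er)))

room : {N : ℕ} {e : Fin k → Fin N} → Increasing e → ∀ d (j : Fin k) →
       d + toℕ j < k → d + toℕ (e j) < N
room {e = e} inc zero    j _  = toℕ<n (e j)
room {k} {e = e} inc (suc d) j lt = ℕ.≤-<-trans shift (room inc d j' lt')
  where
  j+1<k : suc (toℕ j) < k
  j+1<k = ℕ.≤-<-trans (s≤s (ℕ.m≤n+m (toℕ j) d)) lt
  j' : Fin k
  j' = fromℕ< j+1<k
  lt' : d + toℕ j' < k
  lt' = subst (λ t → d + t < k) (sym (toℕ-fromℕ< j+1<k)) (subst (_< k) (sym (ℕ.+-suc d (toℕ j))) lt)
  shift : suc (d + toℕ (e j)) ≤ d + toℕ (e j')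
  shift = subst (_≤ d + toℕ (e j')) (ℕ.+-suc d (toℕ (e j)))
    (ℕ.+-monoʳ-≤ d (inc j j' (subst (toℕ j <_) (sym (toℕ-fromℕ< j+1<k)) (ℕ.n<1+n (toℕ j)))))

maximum-used : {q : Word k} {i₀ j : Fin k} → suc (toℕ (lookup q i₀)) ≡ k →
               (f : Fin (suc n) → Fin (suc n)) ((e , _ , _) : Occurs f q) →
               f (e j) ≡ fromℕ n → f (e i₀) ≡ fromℕ n
maximum-used {n = n} {q = q} {i₀} {j} i₀-max f (e , _ , iff) fej≡last =
  at-least-last (f (e i₀)) (subst (_≤ toℕ (f (e i₀))) (trans (cong toℕ fej≡last) (toℕ-fromℕ n))
    (ℕ.≮⇒≥ (q-not-above ∘ Equivalence.from (iff i₀ j))))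
  where
  q-not-above : ¬ (lookup q i₀ <ᶠ lookup q j)
  q-not-above = ℕ.≤⇒≯ (ℕ.≤-pred (subst (toℕ (lookup q j) <_) (sym i₀-max) (toℕ<n (lookup q j))))

restrict : {N : ℕ} {f : Fin N → Fin N} {h : Fin n → Fin n} {q : Word k}
           (Good : Fin N → Set) (ρ : ∀ u → Good u → Fin n) →
           (∀ {u v} (gu : Good u) (gv : Good v) → u <ᶠ v → ρ u gu <ᶠ ρ v gv) →
           (∀ {u v} (gu : Good u) (gv : Good v) → (f u <ᶠ f v) ⇔ (h (ρ u gu) <ᶠ h (ρ v gv))) →
           ((e , _) : Occurs f q) → (∀ j → Good (e j)) → Occurs h q
restrict Good ρ ρ-inc ρ-order (e , inc , iff) good =
  (λ j → ρ (e j) (good j)) ,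
  (λ j r j<r → ρ-inc (good j) (good r) (inc j r j<r)) ,
  (λ j r → ρ-order (good j) (good r) ⇔-∘ iff j r)

module Avoidance {k : ℕ} (q : Word k) (i₀ : Fin k) (i₀-max : suc (toℕ (lookup q i₀)) ≡ k)
                 (i₀-early : 3 + toℕ i₀ ≤ k) {m : ℕ} (h : Fin (suc m) → Fin (suc m)) where

  -- First extension: anchor m, so the new maximum m + 1 is at position m.
  module First where
    open Insertion (fromℕ m) h

    toℕ-anchor : toℕ (inject₁ (fromℕ m)) ≡ m
    toℕ-anchor = trans (toℕ-inject₁ (fromℕ m)) (toℕ-fromℕ m)

    collapse-increasing : ∀ {u v} → u ≢ inject₁ (fromℕ m) → v ≢ inject₁ (fromℕ m) →
                          u <ᶠ v → collapse (fromℕ m) u <ᶠ collapse (fromℕ m) v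
    collapse-increasing {u} {v} u≢a _ u<v with view u | view v
    ... | ‵fromℕ     | _          = contradiction u<v (not-above-last v)
    ... | ‵inject₁ x | ‵fromℕ     = below-last x (u≢a ∘ cong inject₁)
    ... | ‵inject₁ x | ‵inject₁ y = Equivalence.to (inject₁-order x y) u<v

    collapse-order : ∀ {u v} → u ≢ inject₁ (fromℕ m) → v ≢ inject₁ (fromℕ m) →
                     (g u <ᶠ g v) ⇔ (h (collapse (fromℕ m) u) <ᶠ h (collapse (fromℕ m) v))
    collapse-order u≢a v≢a rewrite g-off-anchor u≢a | g-off-anchor v≢a = inject₁-order _ _

    -- The new maximum sits at position m, with only one position after it, while
    -- q's maximum needs two entries after it.
    occurs-after-last : Occurs g q → Occurs h q
    occurs-after-last occ@(e , inc , _) =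
      restrict {h = h} {q = q} (_≢ inject₁ (fromℕ m)) (λ u _ → collapse (fromℕ m) u)
               collapse-increasing collapse-order occ avoids-anchor
      where
      avoids-anchor : ∀ j → e j ≢ inject₁ (fromℕ m)
      avoids-anchor j ej≡a =
        ℕ.<-irrefl refl (subst (λ t → 2 + t < 2 + m) (trans (cong toℕ ei₀≡a) toℕ-anchor)
                                (room inc 2 i₀ i₀-early))
        where
        ei₀≡a : e i₀ ≡ inject₁ (fromℕ m)
        ei₀≡a = g-new-preimage
          (maximum-used {q = q} {i₀} {j} i₀-max g occ (trans (cong g ej≡a) g-anchor))

  -- Second extension: anchor a with h a = m, so m + 1 replaces m and m is
  -- appended at the new last position.
  module Second (q-inv : ∀ i → lookup q (lookup q i) ≡ i)
                (r : Fin k) (r-second : suc (suc (toℕ (lookup q r))) ≡ k)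
                (h-inj : Injective _≡_ _≡_ h) (a : Fin (suc m)) (ha : h a ≡ fromℕ m) where
    open Insertion a h

    -- On old positions g is h with the maximum m raised to m + 1, which keeps
    -- the relative order of values.
    old-order : ∀ x y → (g (inject₁ x) <ᶠ g (inject₁ y)) ⇔ (h x <ᶠ h y)
    old-order x y with x ≟ a | y ≟ a
    ... | yes refl | yes refl = mk⇔ (⊥-elim ∘ ℕ.<-irrefl refl) (⊥-elim ∘ ℕ.<-irrefl refl)
    ... | yes refl | no  y≢a rewrite g-anchor | g-old y≢a | ha =
      mk⇔ (λ lt → contradiction lt (not-above-last _)) (λ lt → contradiction lt (not-above-last _))
    ... | no  x≢a  | yes refl rewrite g-old x≢a | g-anchor | ha =
      mk⇔ (λ _ → below-last (h x) (x≢a ∘ h-inj ∘ λ hx≡m → trans hx≡m (sym ha)))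
          (λ _ → below-last (inject₁ (h x)) (fromℕ≢inject₁ ∘ sym))
    ... | no  x≢a  | no  y≢a rewrite g-old x≢a | g-old y≢a = inject₁-order (h x) (h y)

    OldPosition : Fin (suc (suc m)) → Set
    OldPosition u = ∃ λ x → inject₁ x ≡ u

    old-position : ∀ u → u ≢ fromℕ (suc m) → OldPosition u
    old-position u u≢new with view u
    ... | ‵fromℕ     = contradiction refl u≢new
    ... | ‵inject₁ x = x , refl

    old-increasing : ∀ {u v} (gu : OldPosition u) (gv : OldPosition v) →
                     u <ᶠ v → proj₁ gu <ᶠ proj₁ gv
    old-increasing (x , refl) (y , refl) = Equivalence.to (inject₁-order x y)

    old-restricted-order : ∀ {u v} (gu : OldPosition u) (gv : OldPosition v) →
                           (g u <ᶠ g v) ⇔ (h (proj₁ gu) <ᶠ h (proj₁ gv))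
    old-restricted-order (x , refl) (y , refl) = old-order x y

    -- An occurrence using the new last position (value m) would place it at the
    -- last index k - 1 = q_{i₀}, so q_{k-1} = i₀; both q_{i₀} = k - 1 and
    -- q_r = k - 2 exceed i₀, so both must be matched by the single value m + 1.
    occurs-after-max : Occurs g q → Occurs h q
    occurs-after-max occ@(e , inc , iff) =
      restrict {h = h} {q = q} OldPosition (λ _ → proj₁) old-increasing old-restricted-order occ
               (λ j → old-position (e j) (avoids-new j))
      where
      avoids-new : ∀ j → e j ≢ fromℕ (suc m)
      avoids-new j ej≡new = ℕ.1+n≢n (sym q-i₀≡q-r)
        where
        toℕ-ej : toℕ (e j) ≡ suc m
        toℕ-ej = trans (cong toℕ ej≡new) (toℕ-fromℕ (suc m))

        -- No position follows the new last one, so j is the last index.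
        j-last : suc (toℕ j) ≡ k
        j-last with ℕ.m≤n⇒m<n∨m≡n (toℕ<n j)
        ... | inj₂ j+1≡k = j+1≡k
        ... | inj₁ j+1<k = ⊥-elim (ℕ.<-irrefl refl
                (subst (λ t → suc t < suc (suc m)) toℕ-ej (room inc 1 j j+1<k)))

        qj≡i₀ : lookup q j ≡ i₀
        qj≡i₀ = trans (cong (lookup q) (toℕ-injective (ℕ.suc-injective (trans j-last (sym i₀-max)))))
                      (q-inv i₀)

        value-ej : toℕ (g (e j)) ≡ m
        value-ej = begin
          toℕ (g (e j))            ≡⟨ cong (toℕ ∘ g) ej≡new ⟩
          toℕ (g (fromℕ (suc m)))  ≡⟨ cong toℕ (trans g-new (cong inject₁ ha)) ⟩
          toℕ (inject₁ (fromℕ m))  ≡⟨ toℕ-inject₁ (fromℕ m) ⟩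
          toℕ (fromℕ m)            ≡⟨ toℕ-fromℕ m ⟩
          m                        ∎
          where open ≡-Reasoning

        -- Values above g (e j) = m can only be m + 1, taken at the anchor.
        above : ∀ s → toℕ i₀ < toℕ (lookup q s) → e s ≡ inject₁ a
        above s i₀<qs = g-new-preimage (at-least-last (g (e s))
          (subst (_< toℕ (g (e s))) value-ej
            (Equivalence.to (iff j s) (subst (λ t → toℕ t < toℕ (lookup q s)) (sym qj≡i₀) i₀<qs))))

        i₀<q-i₀ : toℕ i₀ < toℕ (lookup q i₀)
        i₀<q-i₀ = ℕ.<⇒≤ (ℕ.≤-pred (subst (3 + toℕ i₀ ≤_) (sym i₀-max) i₀-early))

        i₀<q-r : toℕ i₀ < toℕ (lookup q r)
        i₀<q-r = ℕ.≤-pred (ℕ.≤-pred (subst (3 + toℕ i₀ ≤_) (sym r-second) i₀-early))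

        i₀≡r : i₀ ≡ r
        i₀≡r = increasing-injective inc (trans (above i₀ i₀<q-i₀) (sym (above r i₀<q-r)))

        q-i₀≡q-r : suc (toℕ (lookup q r)) ≡ suc (suc (toℕ (lookup q r)))
        q-i₀≡q-r = trans (subst (λ t → suc (toℕ (lookup q t)) ≡ k) i₀≡r i₀-max) (sym r-second)

-- The position of the largest value n of a word of length n + 1 (0 if absent).
positionOfMax : Word (suc n) → Fin (suc n)
positionOfMax {n} p with any? (λ x → lookup p x ≟ fromℕ n)
... | yes (x , _) = x
... | no  _       = zero

positionOfMax-spec : (p : Word (suc n)) → Surjective _≡_ _≡_ (lookup p) →
                     lookup p (positionOfMax p) ≡ fromℕ n
positionOfMax-spec {n} p surj with any? (λ x → lookup p x ≟ fromℕ n)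
... | yes (_ , px) = px
... | no  none     = contradiction (proj₁ (surj (fromℕ n)) , proj₂ (surj (fromℕ n)) refl) none

cycAv-≡ : {q : Word k} {x y : CycAv q n} → proj₁ x ≡ proj₁ y → x ≡ y
cycAv-≡ {x = p , _} {y = .p , _} refl = refl

module Growth {k : ℕ} (q : Word k) (q-inv : ∀ i → lookup q (lookup q i) ≡ i)
              (i₀ : Fin k) (i₀-max : suc (toℕ (lookup q i₀)) ≡ k) (i₀-early : 3 + toℕ i₀ ≤ k)
              (r : Fin k) (r-second : suc (suc (toℕ (lookup q r))) ≡ k) {m : ℕ} where

  extendAt : (anchor : Word (suc m) → Fin (suc m)) →
             (∀ p → IsCyclic p → Occurs (insertAfter (anchor p) (lookup p)) q → Occurs (lookup p) q) →
             CycAv q (suc m) → CycAv q (suc (suc m))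
  extendAt anchor restricts (p , [ pf ]) =
    extend p (anchor p) ,
    [ extend-cyclic {p = p} (anchor p) (proj₁ pf) ,
      proj₂ pf ∘ restricts p (proj₁ pf)
               ∘ occurs-cong {q = q} (lookup∘tabulate (insertAfter (anchor p) (lookup p))) ]

  first : CycAv q (suc m) → CycAv q (suc (suc m))
  first = extendAt (λ _ → fromℕ m)
    (λ p _ → Avoidance.First.occurs-after-last q i₀ i₀-max i₀-early (lookup p))

  second : CycAv q (suc m) → CycAv q (suc (suc m))
  second = extendAt positionOfMax (λ p ((p-inj , p-surj) , _) →
    Avoidance.Second.occurs-after-max q i₀ i₀-max i₀-early (lookup p) q-inv r r-second
      p-inj (positionOfMax p) (positionOfMax-spec p p-surj))

  grow : CycAv q (suc m) ⊎ CycAv q (suc m) → CycAv q (suc (suc m))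
  grow (inj₁ x) = first x
  grow (inj₂ x) = second x

-- A cyclic permutation of length ≥ 2 does not fix its last point, so the two
-- extensions of such permutations have different anchors.
anchors-differ : (p : Word (suc (suc n))) → IsCyclic p → fromℕ (suc n) ≢ positionOfMax p
anchors-differ {n} p ((_ , p-surj) , p-cyc) last≡max
  with cyclic-fixed-point p-cyc (trans (cong (lookup p) last≡max) (positionOfMax-spec p p-surj)) zero
... | ()

grow-injective : ∀ {k} (q : Word k) q-inv i₀ i₀-max i₀-early r r-second {m} →
                 Injective _≡_ _≡_ (Growth.grow q q-inv i₀ i₀-max i₀-early r r-second {suc m})
grow-injective q _ _ _ _ _ _ {m} {inj₁ (p , _)} {inj₁ (p' , _)} eq =
  cong inj₁ (cycAv-≡ {q = q} (proj₂ (extend-injective {p = p} {p'} (cong proj₁ eq))))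
grow-injective q _ _ _ _ _ _ {m} {inj₂ (p , _)} {inj₂ (p' , _)} eq =
  cong inj₂ (cycAv-≡ {q = q} (proj₂ (extend-injective {p = p} {p'} (cong proj₁ eq))))
grow-injective q _ _ _ _ _ _ {m} {inj₁ (p' , _)} {inj₂ (p , [ pf ])} eq =
  ⊥-elim-irr (anchors-differ p (proj₁ pf) (proj₁ (extend-injective {p = p'} {p} (cong proj₁ eq))))
grow-injective q _ _ _ _ _ _ {m} {inj₂ (p , [ pf ])} {inj₁ (p' , _)} eq =
  ⊥-elim-irr (anchors-differ p (proj₁ pf) (proj₁ (extend-injective {p = p'} {p} (cong proj₁ (sym eq)))))

twice≤ : {X Y : Set} {c d : ℕ} → Fin c ↔ X → Fin d ↔ Y → (X ⊎ X) ↣ Y → 2 * c ≤ d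
twice≤ {c = c} {d} Fc Fd f =
  subst (_≤ d) (cong (c +_) (sym (ℕ.+-identityʳ c))) (injective⇒≤ (Injection.injective embedding))
  where
  embedding : Fin (c + c) ↣ Fin d
  embedding = ↔⇒↣ (↔-sym Fd) ↣-∘ (f ↣-∘ ↔⇒↣ ((Fc ⊎-↔ Fc) ↔-∘ +↔⊎))

theorem23 : (k : ℕ) (q : Word k) → 2 < k → IsInvolution q →
            (∀ (i : Fin k) → suc (toℕ (lookup q i)) ≡ k → toℕ i + 3 ≤ k) →
            (n : ℕ) → 2 ≤ n → (c d : ℕ) →
            (Fin c ↔ CycAv q n) → (Fin d ↔ CycAv q (suc n)) →
            2 * c ≤ d
theorem23 (suc (suc k₂)) q (s≤s (s≤s _)) ((_ , q-surj) , q-inv) max-early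
          (suc (suc m)) (s≤s (s≤s _)) c d Cₙ Cₙ₊₁ =
  twice≤ Cₙ Cₙ₊₁ (mk↣ (grow-injective q q-inv i₀ i₀-max i₀-early r r-second))
  where
  i₀ : Fin (suc (suc k₂))
  i₀ = proj₁ (q-surj (fromℕ (suc k₂)))
  i₀-max : suc (toℕ (lookup q i₀)) ≡ suc (suc k₂)
  i₀-max = cong suc (trans (cong toℕ (proj₂ (q-surj (fromℕ (suc k₂))) refl)) (toℕ-fromℕ (suc k₂)))
  i₀-early : 3 + toℕ i₀ ≤ suc (suc k₂)
  i₀-early = subst (_≤ suc (suc k₂)) (ℕ.+-comm (toℕ i₀) 3) (max-early i₀ i₀-max)
  r : Fin (suc (suc k₂))
  r = proj₁ (q-surj (inject₁ (fromℕ k₂)))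
  r-second : suc (suc (toℕ (lookup q r))) ≡ suc (suc k₂)
  r-second = cong (suc ∘ suc) (trans (cong toℕ (proj₂ (q-surj (inject₁ (fromℕ k₂))) refl))
                                     (trans (toℕ-inject₁ (fromℕ k₂)) (toℕ-fromℕ k₂)))
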